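{- Let $q\ge 3$ and $p\ge 2$ be integers. Suppose that a connected graph $H$ with at least $3(q+p)^{2qp}$ vertices does not contain a subgraph isomorphic to $S_{q,p}$. If $\Delta(H)\ge q$, then $H$ contains neither the cycle $C_{p+1}$ nor the broken fan $B_{p+2}$ as a subgraph.
   Context: Graphs are finite and simple; "subgraph" means not necessarily induced subgraph. $\Delta(H)$ is the maximum vertex degree of $H$. The sparkler graph $S_{q,p}$ is obtained from the star $K_{1,q-1}$ and the path $P_p$ (on $p$ vertices) by adding an edge between an end vertex of $P_p$ and the central vertex of $K_{1,q-1}$. $C_{p+1}$ is the cycle on $p+1$ vertices. The broken fan $B_{p+2}$ is the graph on $p+2$ vertices $y,y',y_1,\dots,y_p$ whose edges are $y_iy_{i+1}$ for $1\le i<p$, $yy_i$ for $1\le i\le p-1$, and $yy'$ (i.e., take the fan consisting of a path $y_1\dots y_p$ plus a vertex $y$ adjacent to all $y_i$, remove the edge $yy_p$, and add a new vertex $y'$ adjacent to $y$ only). -}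

module Defs where

open import Data.Nat using (ℕ; zero; suc; _+_; _*_; _≤_; _<_; _⊔_)
open import Data.Fin using (Fin; toℕ)
open import Data.Bool using (Bool; true; false; if_then_else_)
open import Data.List using (List; map; foldr; allFin)
open import Data.Nat.ListAction using (sum)
open import Data.Product using (_×_; Σ; ∃)
open import Data.Sum using (_⊎_)
open import Data.Empty using (⊥)
open import Relation.Binary.PropositionalEquality using (_≡_)
open import Relation.Binary.Construct.Closure.ReflexiveTransitive using (Star)
open import Function.Definitions using (Injective)

record Graph (n : ℕ) : Set where
  field
    adj     : Fin n → Fin n → Bool
    adj-sym : ∀ u v → adj u v ≡ adj v u
    irrefl  : ∀ v → adj v v ≡ false
open Graph public

Edge : ∀ {n} → Graph n → Fin n → Fin n → Set
Edge G u v = adj G u v ≡ true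

Connected : ∀ {n} → Graph n → Set
Connected {n} G = ∀ (u v : Fin n) → Star (Edge G) u v

degree : ∀ {n} → Graph n → Fin n → ℕ
degree {n} G u = sum (map (λ v → if adj G u v then 1 else 0) (allFin n))

maxDegree : ∀ {n} → Graph n → ℕ
maxDegree {n} G = foldr _⊔_ 0 (map (degree G) (allFin n))

-- A pattern graph given by an edge relation on ℕ labels, restricted to Fin m.
SymRel : (ℕ → ℕ → Set) → ℕ → ℕ → Set
SymRel R i j = R i j ⊎ R j i

ContainsSub : ∀ {m n} → (Fin m → Fin m → Set) → Graph n → Set
ContainsSub {m} {n} FE G =
  Σ (Fin m → Fin n) λ f → Injective _≡_ _≡_ f × (∀ u v → FE u v → Edge G (f u) (f v))

-- Sparkler S_{q,p} on vertices 0..q+p-1: centre 0, star leaves 1..q-1,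
-- path q, q+1, ..., q+p-1, and the extra edge 0—q.
sparklerR : ℕ → ℕ → ℕ → ℕ → Set
sparklerR q p i j = (i ≡ 0 × 1 ≤ j × j ≤ q) ⊎ (q ≤ i × suc i ≡ j × j < q + p)

Sparkler : (q p : ℕ) → Fin (q + p) → Fin (q + p) → Set
Sparkler q p u v = SymRel (sparklerR q p) (toℕ u) (toℕ v)

cycleR : ℕ → ℕ → ℕ → Set
cycleR p i j = (suc i ≡ j × j ≤ p) ⊎ (i ≡ 0 × j ≡ p)

Cycle : (p : ℕ) → Fin (suc p) → Fin (suc p) → Set
Cycle p u v = SymRel (cycleR p) (toℕ u) (toℕ v)

-- Broken fan B_{p+2} on vertices 0..p+1: y = 0, y' = 1, y_i = i+1 (1 ≤ i ≤ p).
-- Edges: y_i y_{i+1} (1 ≤ i < p), i.e. k—k+1 for 2 ≤ k ≤ p;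
--        y y_i (1 ≤ i ≤ p-1), i.e. 0—k for 2 ≤ k ≤ p;  and y y' = 0—1.
brokenFanR : ℕ → ℕ → ℕ → Set
brokenFanR p i j =
  (2 ≤ i × i ≤ p × suc i ≡ j) ⊎ (i ≡ 0 × 2 ≤ j × j ≤ p) ⊎ (i ≡ 0 × j ≡ 1)

BrokenFan : (p : ℕ) → Fin (suc (suc p)) → Fin (suc (suc p)) → Set
BrokenFan p u v = SymRel (brokenFanR p) (toℕ u) (toℕ v)

module Submission where

-- Write q = r + 1 and p = p′ + 1. Each vertex of C_{p+1} and of B_{p+2} starts a path through p further
-- vertices of the pattern, so each vertex of a copy X of either pattern in H carries such a pendant path
-- inside X. Prepending the layers of a breadth-first search from X carries pendant paths to every vertex
-- of the connected graph H, so a vertex of degree at least r + p yields S_{q,p}. Otherwise Δ(H) < r + p,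
-- and the ball of radius p′ around a vertex v of degree at least q has at most (r + p)^{p′} < |H| vertices.
-- The first p vertices of a geodesic leaving this ball meet the neighbourhood of v only in their first
-- vertex, and the remaining r neighbours of v complete S_{q,p}.

open import Defs
open import Data.Nat using (ℕ; _+_; _*_; _^_; _≤_)
open import Data.Product using (_×_)
open import Relation.Nullary using (¬_)

open import Data.Nat using (zero; suc; _<_; _∸_; z≤n; s≤s; _≤?_; _<?_)
open import Data.Nat.Properties
open import Data.Nat.ListAction using (sum)
open import Data.Bool using (true; false; if_then_else_)
import Data.Bool.Properties as Bool
open import Data.Fin using (Fin; toℕ; fromℕ<)
import Data.Fin as Fin
open import Data.Fin.Properties
  using (toℕ-injective; toℕ<n; fromℕ<-toℕ; toℕ-fromℕ<; fromℕ<-injective; any?; all?; ¬∀⟶∃¬; pigeonhole)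
  renaming (_≟_ to _≟ᶠ_)
open import Data.List using (List; []; _∷_; _++_; map; filter; length; lookup; allFin; concatMap)
open import Data.List.Properties using (length-++; foldr-preservesᵇ)
open import Data.List.Membership.Propositional using (_∈_)
open import Data.List.Membership.Propositional.Properties
  using (∈-filter⁻; ∈-filter⁺; ∈-allFin; ∈-++⁺ˡ; ∈-++⁺ʳ; ∈-concatMap⁺)
open import Data.List.Relation.Unary.All using (All; []; _∷_)
import Data.List.Relation.Unary.All as All
import Data.List.Relation.Unary.All.Properties as All
open import Data.List.Relation.Unary.Any using (here; there; index)
import Data.List.Relation.Unary.Any as Any
open import Data.List.Relation.Unary.Any.Properties using (lookup-index)
open import Data.List.Relation.Unary.Unique.Propositional using (Unique; _∷_)
import Data.List.Relation.Unary.Unique.Propositional.Properties as Unique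
open import Data.Product using (∃; _,_; proj₁; proj₂)
open import Data.Sum using (_⊎_; inj₁; inj₂; [_,_]′)
open import Data.Empty using (⊥-elim)
open import Function using (_∘_)
open import Function.Definitions using (Injective)
open import Level using (0ℓ)
open import Relation.Nullary using (yes; no)
open import Relation.Nullary.Decidable using (_×-dec_; _⊎-dec_; ¬?)
open import Relation.Unary using (Pred; Decidable; _⊆_; U)
open import Relation.Binary.Definitions using (DecidableEquality; tri<; tri≈; tri>)
open import Relation.Binary.PropositionalEquality using (_≡_; _≢_; refl; sym; trans; cong; subst; subst₂)
open import Relation.Binary.Construct.Closure.ReflexiveTransitive using (Star; ε; _◅_)

InjectiveBelow : {A : Set} → ℕ → (ℕ → A) → Set
InjectiveBelow k w = ∀ {i j} → i < k → j < k → w i ≡ w j → i ≡ j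

-- The path c, vertex 0, …, vertex (p − 1) in E; vertex is junk at indices ≥ p.
record PendantPath {A : Set} (E : A → A → Set) (S : Pred A 0ℓ) (c : A) (p : ℕ) : Set where
  field
    vertex    : ℕ → A
    start     : E c (vertex 0)
    step      : ∀ {j} → suc j < p → E (vertex j) (vertex (suc j))
    injective : InjectiveBelow p vertex
    avoids    : ∀ {j} → j < p → c ≢ vertex j
    inside    : ∀ {j} → j < p → S (vertex j)

module _ {A : Set} {E : A → A → Set} {S : Pred A 0ℓ} where

  shorten : ∀ {c m p} → m ≤ p → PendantPath E S c p → PendantPath E S c m
  shorten m≤p P = record
    { vertex = vertex ; start = start
    ; step = λ lt → step (≤-trans lt m≤p)
    ; injective = λ i<m j<m → injective (≤-trans i<m m≤p) (≤-trans j<m m≤p)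
    ; avoids = λ lt → avoids (≤-trans lt m≤p)
    ; inside = λ lt → inside (≤-trans lt m≤p) }
    where open PendantPath P

  weaken : ∀ {S′ c p} → S ⊆ S′ → PendantPath E S c p → PendantPath E S′ c p
  weaken S⊆S′ P = record
    { vertex = vertex ; start = start ; step = step ; injective = injective ; avoids = avoids
    ; inside = λ lt → S⊆S′ (inside lt) }
    where open PendantPath P

  prepend : ∀ {y z p} → E y z → ¬ S y → S z → PendantPath E S z p → PendantPath E S y (suc p)
  prepend {y} {z} {p} yz y∉S z∈S P = record
    { vertex = vertex′ ; start = yz ; step = step′ ; injective = injective′
    ; avoids = avoids′ ; inside = inside′ }
    where
    open PendantPath P
    vertex′ : ℕ → _
    vertex′ zero = z
    vertex′ (suc j) = vertex j
    step′ : ∀ {j} → suc j < suc p → E (vertex′ j) (vertex′ (suc j))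
    step′ {zero} _ = start
    step′ {suc j} (s≤s lt) = step lt
    injective′ : InjectiveBelow (suc p) vertex′
    injective′ {zero} {zero} _ _ _ = refl
    injective′ {zero} {suc j} _ (s≤s lt) eq = ⊥-elim (avoids lt eq)
    injective′ {suc i} {zero} (s≤s lt) _ eq = ⊥-elim (avoids lt (sym eq))
    injective′ {suc i} {suc j} (s≤s li) (s≤s lj) eq = cong suc (injective li lj eq)
    inside′ : ∀ {j} → j < suc p → S (vertex′ j)
    inside′ {zero} _ = z∈S
    inside′ {suc j} (s≤s lt) = inside lt
    avoids′ : ∀ {j} → j < suc p → y ≢ vertex′ j
    avoids′ lt eq = y∉S (subst S (sym eq) (inside′ lt))

module _ {A B : Set} {E : A → A → Set} {F : B → B → Set} {S : Pred A 0ℓ} {T : Pred B 0ℓ}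
         (g : A → B)
         (g-injective : ∀ {a b} → S a → S b → g a ≡ g b → a ≡ b)
         (g-edge : ∀ {a b} → S a → S b → E a b → F (g a) (g b))
         (g-inside : ∀ {a} → S a → T (g a)) where

  mapPendant : ∀ {c p} → S c → PendantPath E S c (suc p) → PendantPath F T (g c) (suc p)
  mapPendant c∈S P = record
    { vertex = λ j → g (vertex j)
    ; start = g-edge c∈S (inside (s≤s z≤n)) start
    ; step = λ lt → g-edge (inside (≤-trans (n≤1+n _) lt)) (inside lt) (step lt)
    ; injective = λ li lj eq → injective li lj (g-injective (inside li) (inside lj) eq)
    ; avoids = λ lt eq → avoids lt (g-injective c∈S (inside lt) eq)
    ; inside = λ lt → g-inside (inside lt) }
    where
    open PendantPath P

module _ {A : Set} where

  lookupOr : A → List A → ℕ → A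
  lookupOr d [] j = d
  lookupOr d (x ∷ xs) zero = x
  lookupOr d (x ∷ xs) (suc j) = lookupOr d xs j

  lookupOr-∈ : ∀ d xs {j} → j < length xs → lookupOr d xs j ∈ xs
  lookupOr-∈ d (x ∷ xs) {zero} _ = here refl
  lookupOr-∈ d (x ∷ xs) {suc j} (s≤s lt) = there (lookupOr-∈ d xs lt)

  lookupOr-injective : ∀ d {xs} → Unique xs → InjectiveBelow (length xs) (lookupOr d xs)
  lookupOr-injective d (x∉xs ∷ u) {zero} {zero} _ _ _ = refl
  lookupOr-injective d {x ∷ xs} (x∉xs ∷ u) {zero} {suc j} _ (s≤s lt) eq =
    ⊥-elim (All.lookup x∉xs (lookupOr-∈ d xs lt) eq)
  lookupOr-injective d {x ∷ xs} (x∉xs ∷ u) {suc i} {zero} (s≤s lt) _ eq =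
    ⊥-elim (All.lookup x∉xs (lookupOr-∈ d xs lt) (sym eq))
  lookupOr-injective d (x∉xs ∷ u) {suc i} {suc j} (s≤s li) (s≤s lj) eq =
    cong suc (lookupOr-injective d u li lj eq)

  length-filter-∷ : ∀ {P : Pred A 0ℓ} (P? : Decidable P) x xs →
                    length (filter P? xs) ≤ length (filter P? (x ∷ xs))
  length-filter-∷ P? x xs with P? x
  ... | yes _ = n≤1+n _
  ... | no _ = ≤-refl

  length-filter-∅ : ∀ {P : Pred A 0ℓ} (P? : Decidable P) {xs} → All (¬_ ∘ P) xs → length (filter P? xs) ≡ 0
  length-filter-∅ P? [] = refl
  length-filter-∅ P? {x ∷ xs} (¬px ∷ ¬Ps) with P? x
  ... | yes px = ⊥-elim (¬px px)
  ... | no _ = length-filter-∅ P? ¬Ps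

  module _ {P Q R : Pred A 0ℓ} (P? : Decidable P) (Q? : Decidable Q) (R? : Decidable R)
           (P⊆Q∪R : ∀ {x} → P x → Q x ⊎ R x) where

    length-filter-⊎ : ∀ xs → length (filter P? xs) ≤ length (filter Q? xs) + length (filter R? xs)
    length-filter-⊎ [] = z≤n
    length-filter-⊎ (x ∷ xs) with P? x
    ... | no _ = ≤-trans (length-filter-⊎ xs) (+-mono-≤ (length-filter-∷ Q? x xs) (length-filter-∷ R? x xs))
    ... | yes px with Q? x
    ...   | yes _ = s≤s (≤-trans (length-filter-⊎ xs) (+-monoʳ-≤ _ (length-filter-∷ R? x xs)))
    ...   | no ¬qx with R? x
    ...     | yes _ = ≤-trans (s≤s (length-filter-⊎ xs)) (≤-reflexive (sym (+-suc _ _)))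
    ...     | no ¬rx = ⊥-elim ([ ¬qx , ¬rx ]′ (P⊆Q∪R px))

  OnPath : (ℕ → A) → ℕ → Pred A 0ℓ
  OnPath w k z = ∃ λ j → j < k × w j ≡ z

module WithDecidableEquality {A : Set} (_≟_ : DecidableEquality A) where

  length-filter-≡ : ∀ a {xs} → Unique xs → length (filter (a ≟_) xs) ≤ 1
  length-filter-≡ a {[]} _ = z≤n
  length-filter-≡ a {x ∷ xs} (x∉xs ∷ u) with a ≟ x
  ... | no _ = length-filter-≡ a u
  ... | yes refl = s≤s (≤-reflexive (length-filter-∅ (a ≟_) x∉xs))

  onPath? : ∀ w k → Decidable (OnPath w k)
  onPath? w zero z = no λ { (j , () , _) }
  onPath? w (suc k) z with onPath? w k z
  ... | yes (j , j<k , eq) = yes (j , m<n⇒m<1+n j<k , eq)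
  ... | no ¬on with w k ≟ z
  ...   | yes eq = yes (k , ≤-refl , eq)
  ...   | no neq = no λ { (j , j<1+k , eq) → [ (λ j<k → ¬on (j , j<k , eq)) , (λ { refl → neq eq }) ]′
                                                (m<1+n⇒m<n∨m≡n j<1+k) }

  length-filter-onPath : ∀ w k {xs} → Unique xs → length (filter (onPath? w k) xs) ≤ k
  length-filter-onPath w zero {xs} _ =
    ≤-reflexive (length-filter-∅ (onPath? w zero) {xs} (All.tabulate λ { _ (_ , () , _) }))
  length-filter-onPath w (suc k) {xs} u = begin
    length (filter (onPath? w (suc k)) xs)
      ≤⟨ length-filter-⊎ (onPath? w (suc k)) (onPath? w k) (w k ≟_) classify xs ⟩
    length (filter (onPath? w k) xs) + length (filter (w k ≟_) xs)
      ≤⟨ +-mono-≤ (length-filter-onPath w k u) (length-filter-≡ (w k) u) ⟩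
    k + 1                                                           ≡⟨ +-comm k 1 ⟩
    suc k                                                           ∎
    where
    open ≤-Reasoning
    classify : ∀ {z} → OnPath w (suc k) z → OnPath w k z ⊎ w k ≡ z
    classify (j , j<1+k , eq) = [ (λ j<k → inj₁ (j , j<k , eq)) , (λ { refl → inj₂ eq }) ]′ (m<1+n⇒m<n∨m≡n j<1+k)

covering⇒n≤length : ∀ {n} (xs : List (Fin n)) → (∀ y → y ∈ xs) → n ≤ length xs
covering⇒n≤length {n} xs covers with length xs <? n
... | no ≮n = ≮⇒≥ ≮n
... | yes <n with pigeonhole <n (index ∘ covers)
...   | i , j , i<j , same = ⊥-elim (<-irrefl (cong toℕ i≡j) i<j)
  where
  i≡j = trans (lookup-index (covers i)) (trans (cong (lookup xs) same) (sym (lookup-index (covers j))))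

data Split (s : ℕ) : ℕ → Set where
  below : ∀ {j} → j < s → Split s j
  above : ∀ t → Split s (s + t)

split : ∀ s j → Split s j
split s j with j <? s
... | yes j<s = below j<s
... | no j≮s = subst (Split s) (m+[n∸m]≡n (≮⇒≥ j≮s)) (above (j ∸ s))

-- The cycle C_{a+s+1} read from a: labels a+1, …, a+s, then 0, …, a−1.
cycleFrom : ℕ → ℕ → ℕ → ℕ
cycleFrom a s j with j <? s
... | yes _ = suc (a + j)
... | no _ = j ∸ s

cycleFrom-< : ∀ {a s j} → j < s → cycleFrom a s j ≡ suc (a + j)
cycleFrom-< {a} {s} {j} j<s with j <? s
... | yes _ = refl
... | no j≮s = ⊥-elim (j≮s j<s)

cycleFrom-≥ : ∀ a s t → cycleFrom a s (s + t) ≡ t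
cycleFrom-≥ a s t with s + t <? s
... | yes s+t<s = ⊥-elim (m+n≮m s t s+t<s)
... | no _ = m+n∸m≡n s t

cycle-succ : ∀ {q i} → suc i ≤ q → SymRel (cycleR q) i (suc i)
cycle-succ i<q = inj₁ (inj₁ (refl , i<q))

cycle-wrap : ∀ {q} → SymRel (cycleR q) q 0
cycle-wrap = inj₂ (inj₂ (refl , refl))

cycleFrom-start : ∀ a s → SymRel (cycleR (a + s)) a (cycleFrom a s 0)
cycleFrom-start a zero = subst (λ x → SymRel (cycleR (a + 0)) x 0) (+-identityʳ a) cycle-wrap
cycleFrom-start a (suc s) =
  subst (λ x → SymRel (cycleR (a + suc s)) x (suc (a + 0))) (+-identityʳ a)
    (cycle-succ (subst (_≤ a + suc s) (+-suc a 0) (+-monoʳ-≤ a (s≤s z≤n))))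

cycleFrom-step : ∀ a s {j} → suc j < a + s → SymRel (cycleR (a + s)) (cycleFrom a s j) (cycleFrom a s (suc j))
cycleFrom-step a s {j} 1+j<a+s with split s j
... | above t = subst₂ (SymRel (cycleR (a + s))) (sym (cycleFrom-≥ a s t)) (sym next)
                  (cycle-succ (≤-trans (s≤s (m≤n+m t s)) (<⇒≤ 1+j<a+s)))
  where
  next : cycleFrom a s (suc (s + t)) ≡ suc t
  next = trans (cong (cycleFrom a s) (sym (+-suc s t))) (cycleFrom-≥ a s (suc t))
... | below j<s with m≤n⇒m<n∨m≡n j<s
...   | inj₁ 1+j<s = subst₂ (SymRel (cycleR (a + s))) (sym (cycleFrom-< j<s)) (sym next)
                       (cycle-succ (subst (_≤ a + s) (trans (+-suc a (suc j)) (cong suc (+-suc a j))) (+-monoʳ-≤ a 1+j<s)))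
  where
  next : cycleFrom a s (suc j) ≡ suc (suc (a + j))
  next = trans (cycleFrom-< 1+j<s) (cong suc (+-suc a j))
...   | inj₂ 1+j≡s = subst₂ (SymRel (cycleR (a + s))) (sym last) (sym next) cycle-wrap
  where
  last : cycleFrom a s j ≡ a + s
  last = trans (cycleFrom-< j<s) (trans (sym (+-suc a j)) (cong (a +_) 1+j≡s))
  next : cycleFrom a s (suc j) ≡ 0
  next = trans (cong (cycleFrom a s) (trans 1+j≡s (sym (+-identityʳ s)))) (cycleFrom-≥ a s 0)

module _ (a s : ℕ) where

  private
    t<a : ∀ {t} → s + t < a + s → t < a
    t<a {t} lt = +-cancelʳ-< s t a (subst (_< a + s) (+-comm s t) lt)

  cycleFrom-avoids : ∀ {j} → j < a + s → a ≢ cycleFrom a s j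
  cycleFrom-avoids {j} j< eq with split s j
  ... | below j<s = <-irrefl (trans eq (cycleFrom-< j<s)) (s≤s (m≤m+n a j))
  ... | above t = <-irrefl (sym (trans eq (cycleFrom-≥ a s t))) (t<a j<)

  cycleFrom-inside : ∀ {j} → j < a + s → cycleFrom a s j < suc (a + s)
  cycleFrom-inside {j} j< with split s j
  ... | below j<s = s≤s (subst (_≤ a + s) (sym (trans (cycleFrom-< j<s) (sym (+-suc a j)))) (+-monoʳ-≤ a j<s))
  ... | above t = s≤s (subst (_≤ a + s) (sym (cycleFrom-≥ a s t)) (≤-trans (<⇒≤ (t<a j<)) (m≤m+n a s)))

  cycleFrom-injective : InjectiveBelow (a + s) (cycleFrom a s)
  cycleFrom-injective {i} {j} i< j< eq = go (split s i) (split s j) i< j< eq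
    where
    mixed : ∀ {i} t → i < s → s + t < a + s → cycleFrom a s i ≢ cycleFrom a s (s + t)
    mixed t i<s lt eq = <-irrefl (trans (sym (cycleFrom-≥ a s t)) (trans (sym eq) (cycleFrom-< i<s)))
       (≤-trans (t<a lt) (≤-trans (m≤m+n a _) (n≤1+n _)))
    go : ∀ {i j} → Split s i → Split s j → i < a + s → j < a + s → cycleFrom a s i ≡ cycleFrom a s j → i ≡ j
    go {i} {j} (below i<s) (below j<s) _ _ eq =
      +-cancelˡ-≡ a i j (suc-injective (trans (sym (cycleFrom-< i<s)) (trans eq (cycleFrom-< j<s))))
    go (below i<s) (above t) _ lt eq = ⊥-elim (mixed t i<s lt eq)
    go (above t) (below j<s) lt _ eq = ⊥-elim (mixed t j<s lt (sym eq))
    go (above t) (above t′) _ _ eq = cong (s +_) (trans (sym (cycleFrom-≥ a s t)) (trans eq (cycleFrom-≥ a s t′)))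

cycle-pendant : ∀ {p a} → a < suc p → PendantPath (SymRel (cycleR p)) (_< suc p) a p
cycle-pendant {p} {a} (s≤s a≤p) = subst (λ q → PendantPath (SymRel (cycleR q)) (_< suc q) a q) (m+[n∸m]≡n a≤p) (record
  { vertex = cycleFrom a s ; start = cycleFrom-start a s ; step = cycleFrom-step a s
  ; injective = cycleFrom-injective a s ; avoids = cycleFrom-avoids a s ; inside = cycleFrom-inside a s })
  where s = p ∸ a

module BrokenFanPaths (p : ℕ) (2≤p : 2 ≤ p) where

  private
    F = SymRel (brokenFanR p)

  Label : Pred ℕ 0ℓ
  Label x = x < suc (suc p)

  Outside : ℕ → ℕ → Pred ℕ 0ℓ
  Outside lo hi x = Label x × (x < lo ⊎ hi < x)

  spine : ∀ {k ℓ} → 2 ≤ k → k ≤ p → k + ℓ ≤ suc (suc p) → PendantPath F (λ x → k ≤ x × Label x) 0 ℓ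
  spine {k} {ℓ} 2≤k k≤p k+ℓ≤ = record
    { vertex = _+ k
    ; start = inj₁ (inj₂ (inj₁ (refl , 2≤k , k≤p)))
    ; step = λ {j} 1+j<ℓ → inj₁ (inj₁ (≤-trans 2≤k (m≤n+m k j) , ≤-pred (≤-pred (<-below 1+j<ℓ)) , refl))
    ; injective = λ {i} {j} _ _ → +-cancelʳ-≡ k i j
    ; avoids = λ {j} _ eq → <-irrefl eq (<-≤-trans (s≤s z≤n) (≤-trans 2≤k (m≤n+m k j)))
    ; inside = λ {j} j<ℓ → m≤n+m k j , <-below j<ℓ }
    where
    <-below : ∀ {j} → j < ℓ → j + k < suc (suc p)
    <-below {j} j<ℓ = <-≤-trans (+-monoˡ-< k j<ℓ) (subst (_≤ suc (suc p)) (+-comm k ℓ) k+ℓ≤)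

  outside-mono : ∀ {lo lo′ hi} → lo ≤ lo′ → Outside lo hi ⊆ Outside lo′ hi
  outside-mono lo≤lo′ (x∈ , inj₁ x<lo) = x∈ , inj₁ (<-≤-trans x<lo lo≤lo′)
  outside-mono _ (x∈ , inj₂ hi<x) = x∈ , inj₂ hi<x

  y′-tail : ∀ {ℓ hi} → ℓ ≤ 1 → PendantPath F (Outside 2 hi) 0 ℓ
  y′-tail ℓ≤1 = record
    { vertex = λ _ → 1
    ; start = inj₁ (inj₂ (inj₂ (refl , refl)))
    ; step = λ 1+j<ℓ → ⊥-elim (n≮0 (≤-pred (≤-trans 1+j<ℓ ℓ≤1)))
    ; injective = λ i<ℓ j<ℓ _ → trans (n<1⇒n≡0 (<-≤-trans i<ℓ ℓ≤1)) (sym (n<1⇒n≡0 (<-≤-trans j<ℓ ℓ≤1)))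
    ; avoids = λ _ ()
    ; inside = λ _ → s≤s (s≤s z≤n) , inj₁ ≤-refl }

  -- After y: up the spine y_{m+2}, …, y_p when y is adjacent to y_{m+2}, otherwise just y′.
  tail : ∀ m → suc m ≤ p → PendantPath F (Outside 2 (suc (suc m))) 0 (p ∸ suc m)
  tail m 1+m≤p with suc (suc (suc m)) ≤? p
  ... | yes 3+m≤p = weaken (λ { (3+m≤x , x∈) → x∈ , inj₂ 3+m≤x })
                      (spine (s≤s (s≤s z≤n)) 3+m≤p (≤-reflexive (cong (suc ∘ suc) (m+[n∸m]≡n 1+m≤p))))
  ... | no 3+m≰p = y′-tail (m≤n+o⇒m∸n≤o p (suc m) (subst (p ≤_) (+-comm 1 (suc m)) (≤-pred (≰⇒> 3+m≰p))))

  -- From y_{m+1} (label 2 + m) down the spine to y_1, then y and the tail. The path stays clear of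
  -- y_{m+2}, …, y_{m₀+1}, the vertices still to be prepended on the way up to y_{m₀+1}.
  climb : ∀ {m₀} → suc m₀ ≤ p → ∀ m → m ≤ m₀
    → PendantPath F (Outside (3 + m) (2 + m₀)) (2 + m) (suc m + (p ∸ suc m₀))
  climb {m₀} 1+m₀≤p zero _ =
    weaken (outside-mono (n≤1+n 2)) (prepend (inj₂ (inj₂ (inj₁ (refl , ≤-refl , 2≤p))))
      (λ { (_ , inj₁ 2<2) → <-irrefl refl 2<2 ; (_ , inj₂ 2+m₀<2) → ≤⇒≯ (s≤s (s≤s z≤n)) 2+m₀<2 })
      (s≤s z≤n , inj₁ (s≤s z≤n)) (tail m₀ 1+m₀≤p))
  climb {m₀} 1+m₀≤p (suc m) 1+m≤m₀ =
    weaken (outside-mono (n≤1+n _)) (prepend (inj₂ (inj₁ (s≤s (s≤s z≤n) , 2+m≤p , refl)))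
      (λ { (_ , inj₁ x<x) → <-irrefl refl x<x ; (_ , inj₂ 2+m₀<3+m) → ≤⇒≯ (s≤s (s≤s 1+m≤m₀)) 2+m₀<3+m })
      (s≤s (s≤s (≤-trans (n≤1+n _) 2+m≤p)) , inj₁ ≤-refl) (climb 1+m₀≤p m (≤-trans (n≤1+n m) 1+m≤m₀)))
    where
    2+m≤p : 2 + m ≤ p
    2+m≤p = ≤-trans (s≤s 1+m≤m₀) 1+m₀≤p

  fan-pendant : ∀ {a} → Label a → PendantPath F Label a p
  fan-pendant {zero} _ = weaken proj₂ (spine ≤-refl 2≤p ≤-refl)
  fan-pendant {suc zero} _ =
    weaken proj₁ (shorten (n≤1+n p) (prepend {S = Outside 1 1} (inj₂ (inj₂ (inj₂ (refl , refl))))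
      (λ { (_ , inj₁ 1<1) → <-irrefl refl 1<1 ; (_ , inj₂ 1<1) → <-irrefl refl 1<1 })
      (s≤s z≤n , inj₁ (s≤s z≤n))
      (weaken (λ { (2≤x , x∈) → x∈ , inj₂ 2≤x }) (spine ≤-refl 2≤p ≤-refl))))
  fan-pendant {suc (suc m)} (s≤s (s≤s 1+m≤p)) =
    subst (PendantPath F Label (2 + m)) (m+[n∸m]≡n 1+m≤p) (weaken proj₁ (climb 1+m≤p m ≤-refl))

data SparklerLabel (r p : ℕ) : ℕ → Set where
  centre : SparklerLabel r p 0
  leaf   : ∀ k → k < r → SparklerLabel r p (suc k)
  path   : ∀ j → j < p → SparklerLabel r p (suc (r + j))

sparklerLabel : ∀ r p a → a < suc r + p → SparklerLabel r p a
sparklerLabel r p zero _ = centre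
sparklerLabel r p (suc k) (s≤s k<r+p) with split r k
... | below k<r = leaf k k<r
... | above t = path t (+-cancelˡ-< r t p k<r+p)

module _ {n : ℕ} (H : Graph n) where

  edge-sym : ∀ {a b} → Edge H a b → Edge H b a
  edge-sym {a} {b} e = trans (adj-sym H b a) e

  edge⇒≢ : ∀ {a b} → Edge H a b → a ≢ b
  edge⇒≢ {a} e refl with trans (sym e) (irrefl H a)
  ... | ()

  module SparklerMap {S r p c} (P : PendantPath (Edge H) S c p) (ℓ : ℕ → Fin n)
    (leaf-edge : ∀ {k} → k < r → Edge H c (ℓ k))
    (ℓ-injective : InjectiveBelow r ℓ)
    (leaf-off-path : ∀ {k} → k < r → ¬ OnPath (PendantPath.vertex P) p (ℓ k)) where

    open PendantPath P renaming (vertex to w)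

    vertexAt : ℕ → Fin n
    vertexAt zero = c
    vertexAt (suc k) with k <? r
    ... | yes _ = ℓ k
    ... | no _ = w (k ∸ r)

    vertexAt-leaf : ∀ {k} → k < r → vertexAt (suc k) ≡ ℓ k
    vertexAt-leaf {k} k<r with k <? r
    ... | yes _ = refl
    ... | no k≮r = ⊥-elim (k≮r k<r)

    vertexAt-path : ∀ j → vertexAt (suc (r + j)) ≡ w j
    vertexAt-path j with r + j <? r
    ... | yes r+j<r = ⊥-elim (m+n≮m r j r+j<r)
    ... | no _ = cong w (m+n∸m≡n r j)

    leaf≢path : ∀ {k j} → k < r → j < p → ℓ k ≢ w j
    leaf≢path k<r j<p eq = leaf-off-path k<r (_ , j<p , sym eq)

    vertexAt-injective : ∀ {a b} → SparklerLabel r p a → SparklerLabel r p b → vertexAt a ≡ vertexAt b → a ≡ b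
    vertexAt-injective centre centre _ = refl
    vertexAt-injective centre (leaf k k<r) eq = ⊥-elim (edge⇒≢ (leaf-edge k<r) (trans eq (vertexAt-leaf k<r)))
    vertexAt-injective centre (path j j<p) eq = ⊥-elim (avoids j<p (trans eq (vertexAt-path j)))
    vertexAt-injective (leaf k k<r) centre eq = ⊥-elim (edge⇒≢ (leaf-edge k<r) (trans (sym eq) (vertexAt-leaf k<r)))
    vertexAt-injective (path j j<p) centre eq = ⊥-elim (avoids j<p (trans (sym eq) (vertexAt-path j)))
    vertexAt-injective (leaf k k<r) (leaf k′ k′<r) eq =
      cong suc (ℓ-injective k<r k′<r (trans (sym (vertexAt-leaf k<r)) (trans eq (vertexAt-leaf k′<r))))
    vertexAt-injective (leaf k k<r) (path j j<p) eq =
      ⊥-elim (leaf≢path k<r j<p (trans (sym (vertexAt-leaf k<r)) (trans eq (vertexAt-path j))))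
    vertexAt-injective (path j j<p) (leaf k k<r) eq =
      ⊥-elim (leaf≢path k<r j<p (trans (sym (vertexAt-leaf k<r)) (trans (sym eq) (vertexAt-path j))))
    vertexAt-injective (path j j<p) (path j′ j′<p) eq =
      cong (suc ∘ (r +_)) (injective j<p j′<p (trans (sym (vertexAt-path j)) (trans eq (vertexAt-path j′))))

    vertexAt-edge : ∀ {a b} → SparklerLabel r p a → b < suc r + p → sparklerR (suc r) p a b
      → Edge H (vertexAt a) (vertexAt b)
    vertexAt-edge {b = b} centre b< (inj₁ (refl , 1≤b , b≤1+r)) with sparklerLabel r p b b<
    ... | centre = ⊥-elim (≤⇒≯ 1≤b (s≤s z≤n))
    ... | leaf k k<r = subst (Edge H c) (sym (vertexAt-leaf k<r)) (leaf-edge k<r)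
    ... | path j j<p with n≤0⇒n≡0 (+-cancelˡ-≤ r j 0 (subst (r + j ≤_) (sym (+-identityʳ r)) (≤-pred b≤1+r)))
    ...   | refl = subst (Edge H c) (sym (vertexAt-path 0)) start
    vertexAt-edge centre _ (inj₂ (1+r≤0 , _)) = ⊥-elim (≤⇒≯ 1+r≤0 (s≤s z≤n))
    vertexAt-edge (leaf k k<r) _ (inj₁ (() , _))
    vertexAt-edge (leaf k k<r) _ (inj₂ (s≤s r≤k , _)) = ⊥-elim (≤⇒≯ r≤k k<r)
    vertexAt-edge (path j j<p) _ (inj₁ (() , _))
    vertexAt-edge (path j j<p) b< (inj₂ (_ , refl , _)) =
      subst₂ (Edge H) (sym (vertexAt-path j)) (trans (sym (vertexAt-path (suc j))) (cong (vertexAt ∘ suc) (+-suc r j)))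
        (step (+-cancelˡ-< r (suc j) p (subst (_< r + p) (sym (+-suc r j)) (≤-pred b<))))

    embedding : ContainsSub (Sparkler (suc r) p) H
    embedding = f , (λ {u} {v} eq → toℕ-injective (vertexAt-injective (label u) (label v) eq)) , f-edge
      where
      label : (u : Fin (suc r + p)) → SparklerLabel r p (toℕ u)
      label u = sparklerLabel r p (toℕ u) (toℕ<n u)
      f : Fin (suc r + p) → Fin n
      f = vertexAt ∘ toℕ
      f-edge : ∀ u v → Sparkler (suc r) p u v → Edge H (f u) (f v)
      f-edge u v (inj₁ uv) = vertexAt-edge (label u) (toℕ<n v) uv
      f-edge u v (inj₂ vu) = edge-sym (vertexAt-edge (label v) (toℕ<n u) vu)

  open WithDecidableEquality (_≟ᶠ_ {n})

  adjacent? : ∀ c → Decidable (Edge H c)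
  adjacent? c v = adj H c v Bool.≟ true

  neighbours : Fin n → List (Fin n)
  neighbours c = filter (adjacent? c) (allFin n)

  degree≡length-neighbours : ∀ c → degree H c ≡ length (neighbours c)
  degree≡length-neighbours c = go (allFin n)
    where
    go : ∀ xs → sum (map (λ v → if adj H c v then 1 else 0) xs) ≡ length (filter (adjacent? c) xs)
    go [] = refl
    go (x ∷ xs) with adj H c x
    ... | true = cong suc (go xs)
    ... | false = go xs

  offPathNeighbours : Fin n → (ℕ → Fin n) → ℕ → List (Fin n)
  offPathNeighbours c w p = filter (λ z → adjacent? c z ×-dec ¬? (onPath? w p z)) (allFin n)

  degree≤offPath+ : ∀ {Q : Pred (Fin n) 0ℓ} (Q? : Decidable Q) c w p
    → (∀ {z} → Edge H c z → OnPath w p z → Q z)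
    → degree H c ≤ length (offPathNeighbours c w p) + length (filter Q? (allFin n))
  degree≤offPath+ {Q} Q? c w p onPath⇒Q = begin
    degree H c                                 ≡⟨ degree≡length-neighbours c ⟩
    length (neighbours c)                      ≤⟨ length-filter-⊎ (adjacent? c) _ Q? classify (allFin n) ⟩
    length (offPathNeighbours c w p) + length (filter Q? (allFin n)) ∎
    where
    open ≤-Reasoning
    classify : ∀ {z} → Edge H c z → (Edge H c z × ¬ OnPath w p z) ⊎ Q z
    classify {z} e with onPath? w p z
    ... | yes on = inj₂ (onPath⇒Q e on)
    ... | no off = inj₁ (e , off)

  sparkler : ∀ {S r p c} (P : PendantPath (Edge H) S c p)
    → r ≤ length (offPathNeighbours c (PendantPath.vertex P) p)
    → ContainsSub (Sparkler (suc r) p) H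
  sparkler {r = r} {p} {c} P r≤ =
    SparklerMap.embedding P ℓ (proj₁ ∘ ℓ-off) ℓ-injective (proj₂ ∘ ℓ-off)
    where
    open PendantPath P renaming (vertex to w)
    off? = λ z → adjacent? c z ×-dec ¬? (onPath? w p z)
    ℓ = lookupOr c (offPathNeighbours c w p)
    ℓ-off : ∀ {k} → k < r → Edge H c (ℓ k) × ¬ OnPath w p (ℓ k)
    ℓ-off k<r = proj₂ (∈-filter⁻ off? {xs = allFin n} (lookupOr-∈ c _ (≤-trans k<r r≤)))
    ℓ-injective : InjectiveBelow r ℓ
    ℓ-injective i<r j<r =
      lookupOr-injective c (Unique.filter⁺ off? (Unique.allFin⁺ n)) (≤-trans i<r r≤) (≤-trans j<r r≤)

  module Distance (X : Pred (Fin n) 0ℓ) (X? : Decidable X) where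

    Within : ℕ → Pred (Fin n) 0ℓ
    Within zero y = X y
    Within (suc k) y = Within k y ⊎ ∃ λ z → Within k z × Edge H z y

    within? : ∀ k → Decidable (Within k)
    within? zero = X?
    within? (suc k) y = within? k y ⊎-dec any? (λ z → within? k z ×-dec adjacent? z y)

    within-mono : ∀ {k k′} → k ≤ k′ → Within k ⊆ Within k′
    within-mono {k′ = zero} z≤n = λ y∈ → y∈
    within-mono {k′ = suc k′} k≤1+k′ with m≤n⇒m<n∨m≡n k≤1+k′
    ... | inj₁ (s≤s k≤k′) = inj₁ ∘ within-mono k≤k′
    ... | inj₂ refl = λ y∈ → y∈

    within-walk : ∀ {k x y} → Within k x → Star (Edge H) x y → ∃ λ k′ → Within k′ y
    within-walk {k} x∈ ε = k , x∈
    within-walk {k} {x} x∈ (e ◅ walk) = within-walk {suc k} (inj₂ (x , x∈ , e)) walk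

    pendant-outward : ∀ {p} → (∀ {z} → X z → PendantPath (Edge H) X z p)
      → ∀ k {y} → Within k y → PendantPath (Edge H) (Within k) y p
    pendant-outward X-pendant zero = X-pendant
    pendant-outward X-pendant (suc k) (inj₁ y∈) = weaken inj₁ (pendant-outward X-pendant k y∈)
    pendant-outward X-pendant (suc k) {y} (inj₂ (z , z∈ , zy)) with within? k y
    ... | yes y∈ = weaken inj₁ (pendant-outward X-pendant k y∈)
    ... | no y∉ = weaken inj₁ (shorten (n≤1+n _) (prepend (edge-sym zy) y∉ z∈ (pendant-outward X-pendant k z∈)))

    Exact : ℕ → Pred (Fin n) 0ℓ
    Exact zero y = X y
    Exact (suc k) y = Within (suc k) y × ¬ Within k y

    exact⇒within : ∀ k {y} → Exact k y → Within k y
    exact⇒within zero y∈ = y∈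
    exact⇒within (suc k) = proj₁

    exact⇒¬within : ∀ {i j y} → i < j → Exact j y → ¬ Within i y
    exact⇒¬within {j = suc j} (s≤s i≤j) (_ , y∉) = y∉ ∘ within-mono i≤j

    exact-unique : ∀ i j {y} → Exact i y → Exact j y → i ≡ j
    exact-unique i j ei ej with <-cmp i j
    ... | tri< i<j _ _ = ⊥-elim (exact⇒¬within i<j ej (exact⇒within i ei))
    ... | tri≈ _ i≡j _ = i≡j
    ... | tri> _ _ j<i = ⊥-elim (exact⇒¬within j<i ei (exact⇒within j ej))

    within⇒exact : ∀ k {y} → Within k y → ∃ λ j → Exact j y
    within⇒exact zero y∈ = 0 , y∈
    within⇒exact (suc k) {y} y∈ with within? k y
    ... | yes y∈′ = within⇒exact k y∈′
    ... | no y∉ = suc k , y∈ , y∉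

    beyond⇒exact : ∀ d k {y} → ¬ Within d y → Within k y → ∃ λ m → d ≤ m × Exact (suc m) y
    beyond⇒exact d k y∉ y∈ with within⇒exact k y∈
    ... | zero , y∈X = ⊥-elim (y∉ (within-mono {0} {d} z≤n y∈X))
    ... | suc m , y-exact with m <? d
    ...   | yes m<d = ⊥-elim (y∉ (within-mono m<d (exact⇒within (suc m) y-exact)))
    ...   | no m≮d = m , ≮⇒≥ m≮d , y-exact

    exact-predecessor : ∀ k {y} → Exact (suc k) y → ∃ λ z → Exact k z × Edge H z y
    exact-predecessor k (inj₁ y∈ , y∉) = ⊥-elim (y∉ y∈)
    exact-predecessor zero (inj₂ (z , z∈ , zy) , _) = z , z∈ , zy
    exact-predecessor (suc k) (inj₂ (z , z∈ , zy) , y∉) = z , (z∈ , λ z∈′ → y∉ (inj₂ (z , z∈′ , zy))) , zy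

  module FromVertex (v : Fin n) where
    open Distance (_≡ v) (_≟ᶠ v)

    record Geodesic (m : ℕ) (y : Fin n) : Set where
      field
        vertex : ℕ → Fin n
        start  : Edge H v (vertex 0)
        step   : ∀ {j} → j < m → Edge H (vertex j) (vertex (suc j))
        exact  : ∀ {j} → j ≤ m → Exact (suc j) (vertex j)
        end    : vertex m ≡ y

    snoc : ∀ {m z y} → Geodesic m z → Edge H z y → Exact (suc (suc m)) y → Geodesic (suc m) y
    snoc {m} {z} {y} G zy y-exact = record
      { vertex = vertex′ ; start = subst (Edge H v) (sym (vertex′-≤ z≤n)) start
      ; step = step′ ; exact = exact′ ; end = vertex′-end }
      where
      open Geodesic G

      vertex′ : ℕ → Fin n
      vertex′ j with j ≤? m
      ... | yes _ = vertex j
      ... | no _ = y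

      vertex′-≤ : ∀ {j} → j ≤ m → vertex′ j ≡ vertex j
      vertex′-≤ {j} j≤m with j ≤? m
      ... | yes _ = refl
      ... | no j≰m = ⊥-elim (j≰m j≤m)

      vertex′-end : vertex′ (suc m) ≡ y
      vertex′-end with suc m ≤? m
      ... | yes 1+m≤m = ⊥-elim (<-irrefl refl 1+m≤m)
      ... | no _ = refl

      step′ : ∀ {j} → j < suc m → Edge H (vertex′ j) (vertex′ (suc j))
      step′ {j} (s≤s j≤m) with m≤n⇒m<n∨m≡n j≤m
      ... | inj₁ j<m = subst₂ (Edge H) (sym (vertex′-≤ j≤m)) (sym (vertex′-≤ j<m)) (step j<m)
      ... | inj₂ refl = subst₂ (Edge H) (sym (trans (vertex′-≤ ≤-refl) end)) (sym vertex′-end) zy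

      exact′ : ∀ {j} → j ≤ suc m → Exact (suc j) (vertex′ j)
      exact′ {j} j≤1+m with m≤n⇒m<n∨m≡n j≤1+m
      ... | inj₁ (s≤s j≤m) = subst (Exact (suc j)) (sym (vertex′-≤ j≤m)) (exact j≤m)
      ... | inj₂ refl = subst (Exact (suc (suc m))) (sym vertex′-end) y-exact

    geodesic : ∀ m {y} → Exact (suc m) y → Geodesic m y
    geodesic zero {y} y-exact with exact-predecessor 0 y-exact
    ... | _ , refl , vy = record
      { vertex = λ _ → y ; start = vy ; step = λ () ; exact = λ { z≤n → y-exact } ; end = refl }
    geodesic (suc m) y-exact with exact-predecessor (suc m) y-exact
    ... | _ , z-exact , zy = snoc (geodesic m z-exact) zy y-exact

    geodesic-pendant : ∀ {m y p} → Geodesic m y → p ≤ suc m → PendantPath (Edge H) U v p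
    geodesic-pendant {m} {p = p} G p≤1+m = record
      { vertex = vertex ; start = start
      ; step = λ 1+j<p → step (≤-pred (≤-trans 1+j<p p≤1+m))
      ; injective = injective ; avoids = avoids ; inside = _ }
      where
      open Geodesic G
      ≤m : ∀ {j} → j < p → j ≤ m
      ≤m j<p = ≤-pred (≤-trans j<p p≤1+m)
      injective : InjectiveBelow p vertex
      injective {i} {j} i<p j<p eq =
        suc-injective (exact-unique (suc i) (suc j) (exact (≤m i<p)) (subst (Exact (suc j)) (sym eq) (exact (≤m j<p))))
      avoids : ∀ {j} → j < p → v ≢ vertex j
      avoids {j} j<p eq = 0≢1+n (exact-unique 0 (suc j) refl (subst (Exact (suc j)) (sym eq) (exact (≤m j<p))))

    -- A neighbour of v lies within distance 1, whereas the j-th vertex of a geodesic is at distance j + 1.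
    geodesic-chordless : ∀ {m y} (G : Geodesic m y) {j z} → Edge H v z → j ≤ m → Geodesic.vertex G j ≡ z → j ≡ 0
    geodesic-chordless G {zero} _ _ _ = refl
    geodesic-chordless G {suc j} {z} vz j≤m refl =
      ⊥-elim (exact⇒¬within {1} {suc (suc j)} (s≤s (s≤s z≤n)) (Geodesic.exact G j≤m) (inj₂ (v , refl , vz)))

    sparkler-from-geodesic : ∀ {r p m y} → suc r ≤ degree H v → p ≤ suc m → Exact (suc m) y
      → ContainsSub (Sparkler (suc r) p) H
    sparkler-from-geodesic {r} {p} {m} deg p≤1+m y-exact = sparkler P (+-cancelʳ-≤ 1 r _ (begin
      r + 1                                          ≡⟨ +-comm r 1 ⟩
      suc r                                          ≤⟨ deg ⟩
      degree H v                                     ≤⟨ degree≤offPath+ (w 0 ≟ᶠ_) v w p first ⟩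
      L + length (filter (w 0 ≟ᶠ_) (allFin n))      ≤⟨ +-monoʳ-≤ L (length-filter-≡ (w 0) (Unique.allFin⁺ n)) ⟩
      L + 1                                          ∎))
      where
      open ≤-Reasoning
      G = geodesic m y-exact
      P = geodesic-pendant G p≤1+m
      w = Geodesic.vertex G
      L = length (offPathNeighbours v w p)
      first : ∀ {z} → Edge H v z → OnPath w p z → w 0 ≡ z
      first vz (j , j<p , refl) with geodesic-chordless G vz (≤-pred (≤-trans j<p p≤1+m)) refl
      ... | refl = refl

    sparkler-from-far-vertex : ∀ {r p′ y} → suc r ≤ degree H v → ¬ Within p′ y → (∃ λ k → Within k y)
      → ContainsSub (Sparkler (suc r) (suc p′)) H
    sparkler-from-far-vertex {p′ = p′} deg y∉ (k , y∈) with beyond⇒exact p′ k y∉ y∈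
    ... | m , p′≤m , y-exact = sparkler-from-geodesic deg (s≤s p′≤m) y-exact

    ball : ℕ → List (Fin n)
    ball zero = v ∷ []
    ball (suc k) = ball k ++ concatMap neighbours (ball k)

    within⇒∈ball : ∀ k {y} → Within k y → y ∈ ball k
    within⇒∈ball zero refl = here refl
    within⇒∈ball (suc k) (inj₁ y∈) = ∈-++⁺ˡ (within⇒∈ball k y∈)
    within⇒∈ball (suc k) {y} (inj₂ (z , z∈ , zy)) =
      ∈-++⁺ʳ (ball k) (∈-concatMap⁺ neighbours
        (Any.map (λ { refl → ∈-filter⁺ (adjacent? z) (∈-allFin y) zy }) (within⇒∈ball k z∈)))

    module _ {D : ℕ} (degree≤D : ∀ z → degree H z ≤ D) where

      length-concatMap-neighbours : ∀ xs → length (concatMap neighbours xs) ≤ length xs * D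
      length-concatMap-neighbours [] = z≤n
      length-concatMap-neighbours (x ∷ xs) = begin
        length (neighbours x ++ concatMap neighbours xs)          ≡⟨ length-++ (neighbours x) ⟩
        length (neighbours x) + length (concatMap neighbours xs)
          ≤⟨ +-mono-≤ (subst (_≤ D) (degree≡length-neighbours x) (degree≤D x)) (length-concatMap-neighbours xs) ⟩
        D + length xs * D                                         ∎
        where open ≤-Reasoning

      length-ball : ∀ k → length (ball k) ≤ suc D ^ k
      length-ball zero = ≤-refl
      length-ball (suc k) = begin
        length (ball k ++ concatMap neighbours (ball k))           ≡⟨ length-++ (ball k) ⟩
        length (ball k) + length (concatMap neighbours (ball k))  ≤⟨ +-monoʳ-≤ _ (length-concatMap-neighbours (ball k)) ⟩
        length (ball k) + length (ball k) * D                      ≡⟨ sym (*-suc (length (ball k)) D) ⟩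
        length (ball k) * suc D                                    ≤⟨ *-monoˡ-≤ (suc D) (length-ball k) ⟩
        suc D ^ k * suc D                                          ≡⟨ *-comm (suc D ^ k) (suc D) ⟩
        suc D ^ suc k                                              ∎
        where open ≤-Reasoning

      all-within⇒n≤ : ∀ k → (∀ y → Within k y) → n ≤ suc D ^ k
      all-within⇒n≤ k all-within =
        ≤-trans (covering⇒n≤length (ball k) (λ y → within⇒∈ball k (all-within y))) (length-ball k)

    sparkler-from-bounded-degree : ∀ {r p′} → (∀ z → degree H z ≤ r + p′) → Connected H
      → suc r ≤ degree H v → suc (r + p′) ^ p′ < n → ContainsSub (Sparkler (suc r) (suc p′)) H
    sparkler-from-bounded-degree {r} {p′} degree≤ connected deg big with all? (within? p′)
    ... | yes near = ⊥-elim (<⇒≱ big (all-within⇒n≤ degree≤ p′ near))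
    ... | no ¬near with ¬∀⟶∃¬ n (Within p′) (within? p′) ¬near
    ...   | y , y∉ = sparkler-from-far-vertex deg y∉ (within-walk refl (connected v y))

  sparkler-from-high-degree : ∀ {r p} (X : Pred (Fin n) 0ℓ) (X? : Decidable X)
    → (∀ {z} → X z → PendantPath (Edge H) X z p)
    → ∀ {x} → (∃ λ k → Distance.Within X X? k x) → r + p ≤ degree H x
    → ContainsSub (Sparkler (suc r) p) H
  sparkler-from-high-degree {r} {p} X X? X-pendant {x} (k , x∈) deg = sparkler P (+-cancelʳ-≤ p r _ (begin
    r + p                                          ≤⟨ deg ⟩
    degree H x                                     ≤⟨ degree≤offPath+ (onPath? w p) x w p (λ _ on → on) ⟩
    L + length (filter (onPath? w p) (allFin n))  ≤⟨ +-monoʳ-≤ L (length-filter-onPath w p (Unique.allFin⁺ n)) ⟩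
    L + p                                          ∎))
    where
    open ≤-Reasoning
    P = Distance.pendant-outward X X? X-pendant k x∈
    w = PendantPath.vertex P
    L = length (offPathNeighbours x w p)

  sparkler-from-pendant-core : ∀ {r p′} (X : Pred (Fin n) 0ℓ) (X? : Decidable X)
    → (∀ {z} → X z → PendantPath (Edge H) X z (suc p′)) → ∃ X → Connected H
    → ∀ {v} → suc r ≤ degree H v → suc (r + p′) ^ p′ < n
    → ContainsSub (Sparkler (suc r) (suc p′)) H
  sparkler-from-pendant-core {r} {p′} X X? X-pendant (x₀ , x₀∈) connected {v} deg big
    with any? (λ x → r + suc p′ ≤? degree H x)
  ... | yes (x , x-deg) = sparkler-from-high-degree X X? X-pendant (within-walk x₀∈ (connected x₀ x)) x-deg
    where open Distance X X? using (within-walk)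
  ... | no ∄high = FromVertex.sparkler-from-bounded-degree v degree≤ connected deg big
    where
    degree≤ : ∀ z → degree H z ≤ r + p′
    degree≤ z = ≤-pred (subst (degree H z <_) (+-suc r p′) (≰⇒> (λ high → ∄high (z , high))))

  Image : ∀ {m} → (Fin m → Fin n) → Pred (Fin n) 0ℓ
  Image f y = ∃ λ i → f i ≡ y

  image? : ∀ {m} (f : Fin m → Fin n) → Decidable (Image f)
  image? f y = any? (λ i → f i ≟ᶠ y)

  -- g reads labels back into Fin m; its default f i at labels ≥ m is never used.
  image-pendant : ∀ {m p} (R : ℕ → ℕ → Set)
    → (∀ {a} → a < m → PendantPath (SymRel R) (_< m) a (suc p))
    → (f : Fin m → Fin n) → Injective _≡_ _≡_ f → (∀ u v → SymRel R (toℕ u) (toℕ v) → Edge H (f u) (f v))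
    → ∀ {z} → Image f z → PendantPath (Edge H) (Image f) z (suc p)
  image-pendant {m} {p} R paths f f-injective f-edge (i , refl) =
    subst (λ z → PendantPath (Edge H) (Image f) z (suc p)) (trans (g-< (toℕ<n i)) (cong f (fromℕ<-toℕ i _)))
      (mapPendant g g-injective g-edge (λ a<m → _ , sym (g-< a<m)) (toℕ<n i) (paths (toℕ<n i)))
    where
    g : ℕ → Fin n
    g a with a <? m
    ... | yes a<m = f (fromℕ< a<m)
    ... | no _ = f i

    g-< : ∀ {a} (a<m : a < m) → g a ≡ f (fromℕ< a<m)
    g-< {a} a<m with a <? m
    ... | yes _ = refl
    ... | no a≮m = ⊥-elim (a≮m a<m)

    g-injective : ∀ {a b} → a < m → b < m → g a ≡ g b → a ≡ b
    g-injective {a} {b} a<m b<m eq = fromℕ<-injective a b a<m b<m (f-injective (trans (sym (g-< a<m)) (trans eq (g-< b<m))))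

    g-edge : ∀ {a b} → a < m → b < m → SymRel R a b → Edge H (g a) (g b)
    g-edge a<m b<m ab = subst₂ (Edge H) (sym (g-< a<m)) (sym (g-< b<m))
      (f-edge _ _ (subst₂ (SymRel R) (sym (toℕ-fromℕ< a<m)) (sym (toℕ-fromℕ< b<m)) ab))

  sparkler-from-pattern : ∀ {r p′ m} (R : ℕ → ℕ → Set)
    → (∀ {a} → a < suc m → PendantPath (SymRel R) (_< suc m) a (suc p′))
    → Connected H → ∀ {v} → suc r ≤ degree H v → suc (r + p′) ^ p′ < n
    → ContainsSub (λ u v → SymRel R (toℕ u) (toℕ v)) H → ContainsSub (Sparkler (suc r) (suc p′)) H
  sparkler-from-pattern R paths connected deg big (f , f-injective , f-edge) =
    sparkler-from-pendant-core (Image f) (image? f) (image-pendant R paths f f-injective f-edge)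
      (f Fin.zero , Fin.zero , refl) connected deg big

maxDegree-witness : ∀ {n} (H : Graph n) {q} → 0 < q → q ≤ maxDegree H → ∃ λ v → q ≤ degree H v
maxDegree-witness {n} H {q} 0<q q≤Δ with any? (λ v → q ≤? degree H v)
... | yes found = found
... | no ∄ = ⊥-elim (≤⇒≯ q≤Δ (foldr-preservesᵇ {P = _< q} ⊔-lub 0<q (All.map⁺ (All.tabulate degree<q))))
  where
  degree<q : ∀ {v} → v ∈ allFin n → degree H v < q
  degree<q {v} _ = ≰⇒> (λ q≤ → ∄ (v , q≤))

size-bound : ∀ r p′ → suc (r + p′) ^ p′ < 3 * (suc r + suc p′) ^ (2 * suc r * suc p′)
size-bound r p′ = begin-strict
  suc (r + p′) ^ p′   ≤⟨ ^-monoˡ-≤ p′ (s≤s (+-monoʳ-≤ r (n≤1+n p′))) ⟩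
  Q ^ p′              ≤⟨ ^-monoʳ-≤ Q (≤-trans (n≤1+n p′) (m≤n*m (suc p′) (2 * suc r))) ⟩
  Q ^ e               <⟨ m<m+n (Q ^ e) (≤-trans (m^n>0 Q e) (m≤m+n (Q ^ e) (Q ^ e + 0))) ⟩
  3 * Q ^ e           ∎
  where
  open ≤-Reasoning
  Q = suc r + suc p′
  e = 2 * suc r * suc p′

lemma7 : (q p n : ℕ) → 3 ≤ q → 2 ≤ p → (H : Graph n)
       → Connected H
       → 3 * (q + p) ^ (2 * q * p) ≤ n
       → ¬ ContainsSub (Sparkler q p) H
       → q ≤ maxDegree H
       → ¬ ContainsSub (Cycle p) H × ¬ ContainsSub (BrokenFan p) H
lemma7 (suc r) (suc p′) n _ 2≤p H connected big no-sparkler Δ≥q =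
  no-sparkler ∘ sparkler-from-pattern H (cycleR p) cycle-pendant connected deg small ,
  no-sparkler ∘ sparkler-from-pattern H (brokenFanR p) (BrokenFanPaths.fan-pendant p 2≤p) connected deg small
  where
  p = suc p′
  deg = proj₂ (maxDegree-witness H (s≤s z≤n) Δ≥q)
  small = <-≤-trans (size-bound r p′) big
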